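{- Let $P\subseteq\mathbb{R}^d$ be a lattice polytope. If $P$ is $3$-convex-normal, then $P$ is $k$-convex-normal for all $k\geq 2$.
   Context: A lattice polytope is the convex hull of finitely many points of $\mathbb{Z}^d$. For a polytope $Q\subseteq\mathbb{R}^d$ with vertex set $\mathrm{ver}(Q)$ set $G(Q):=\bigcup_{v\in\mathrm{ver}(Q)}\big((v+\mathbb{Z}^d)\cap Q\big)$. A rational polytope $P$ is called $k$-convex-normal (for a number $k$) if for all rational $c\in[2,k]$ one has $cP=G((c-1)P)+P$ (Minkowski sum).
   Formalization: All points, hence the polytope P, its dilates, the sets $G(Q)$ and the Minkowski sums, lie in ℚ^d rather than $\mathbb{R}^d$, and k ranges over the rationals. -}

module Defs where

open import Data.Nat using (ℕ; zero; suc)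
open import Data.Fin using (Fin; zero; suc)
open import Data.Integer using (ℤ; +_)
open import Data.Rational using (ℚ; _/_; 0ℚ; 1ℚ; _+_; _*_; _-_; _≤_; _<_)
open import Data.Product using (Σ; ∃; _×_)
open import Relation.Binary.PropositionalEquality using (_≡_)

Point : ℕ → Set
Point d = Fin d → ℚ

PSet : ℕ → Set₁
PSet d = Point d → Set

_≈ₚ_ : ∀ {d} → Point d → Point d → Set
x ≈ₚ y = ∀ i → x i ≡ y i

_+ₚ_ : ∀ {d} → Point d → Point d → Point d
(x +ₚ y) i = x i + y i

_-ₚ_ : ∀ {d} → Point d → Point d → Point d
(x -ₚ y) i = x i - y i

_·ₚ_ : ∀ {d} → ℚ → Point d → Point d
(c ·ₚ x) i = c * x i

ℤ→ℚ : ℤ → ℚ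
ℤ→ℚ z = z / 1

IsIntegral : ∀ {d} → Point d → Set
IsIntegral {d} x = Σ (Fin d → ℤ) λ z → ∀ i → x i ≡ ℤ→ℚ (z i)

sumFin : ∀ n → (Fin n → ℚ) → ℚ
sumFin zero f = 0ℚ
sumFin (suc n) f = f zero + sumFin n (λ j → f (suc j))

conv : ∀ {d} n → (Fin n → Point d) → PSet d
conv {d} n v x =
  Σ (Fin n → ℚ) λ λs →
    (∀ j → 0ℚ ≤ λs j) × (sumFin n λs ≡ 1ℚ) ×
    (∀ i → x i ≡ sumFin n (λ j → λs j * v j i))

latticePolytope : ∀ {d} n → (Fin n → Fin d → ℤ) → PSet d
latticePolytope n v = conv n (λ j i → ℤ→ℚ (v j i))

dilate : ∀ {d} → ℚ → PSet d → PSet d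
dilate c Q x = ∃ λ p → Q p × (x ≈ₚ (c ·ₚ p))

minkowski : ∀ {d} → PSet d → PSet d → PSet d
minkowski A B x = ∃ λ a → ∃ λ b → A a × B b × (x ≈ₚ (a +ₚ b))

IsVertex : ∀ {d} → PSet d → Point d → Set
IsVertex Q v =
  Q v × (∀ x y t → Q x → Q y → 0ℚ < t → t < 1ℚ →
           v ≈ₚ ((t ·ₚ x) +ₚ ((1ℚ - t) ·ₚ y)) → x ≈ₚ v)

G : ∀ {d} → PSet d → PSet d
G Q x = Q x × ∃ λ v → IsVertex Q v × IsIntegral (x -ₚ v)

_≐_ : ∀ {d} → PSet d → PSet d → Set
A ≐ B = (∀ x → A x → B x) × (∀ x → B x → A x)

two three : ℚ
two = + 2 / 1
three = + 3 / 1

ConvexNormal : ∀ {d} → ℚ → PSet d → Set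
ConvexNormal k P =
  ∀ c → two ≤ c → c ≤ k → dilate c P ≐ minkowski (G (dilate (c - 1ℚ) P)) P

{-# OPTIONS --safe #-}
-- Let c > 3 and x = c q with q ∈ P. By induction on c, (c - 1) q = g + p with g ∈ G((c - 2)P)
-- and p ∈ P; by 3-convex-normality at c = 2, p + q = z + r with z ∈ G(P) and r ∈ P. Then
-- x = (g + z) + r, and g + z ∈ G((c - 1)P): it lies in (c - 1)P by convexity, and if
-- g ≡ (c - 2)a and z ≡ b modulo ℤ^d for vertices a, b of P, then g + z ≡ (c - 1)a + (b - a),
-- which is ≡ (c - 1)a because vertices of a lattice polytope are lattice points and (c - 1)a
-- is a vertex of (c - 1)P. The reverse inclusion G((c - 1)P) + P ⊆ cP is convexity.
module Submission where

open import Defs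
open import Data.Nat as ℕ using (ℕ; zero; suc)
import Data.Nat.Coprimality as Coprimality
open import Data.Fin using (Fin; zero; suc)
open import Data.Integer as ℤ using (ℤ; +_)
import Data.Integer.Properties as ℤₚ
open import Data.Rational
  using (ℚ; mkℚ; *≤*; NonZero; >-nonZero; positive; nonNegative;
         0ℚ; 1ℚ; _+_; _*_; _-_; -_; 1/_; _≤_; _<_)
open import Data.Rational.Properties
open import Data.Rational.Solver using (module +-*-Solver)
open +-*-Solver using (solve; con; _:+_; _:-_; _:*_; _:=_)
open import Algebra.Bundles using (CommutativeMonoid)
open import Algebra.Properties.CommutativeSemigroup
  (CommutativeMonoid.commutativeSemigroup +-0-commutativeMonoid)
  using () renaming (interchange to +-interchange)
open import Algebra.Properties.Group +-0-group using () renaming (⁻¹-involutive to neg-involutive)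
open import Data.Product using (∃; ∃₂; _×_; _,_; proj₁; proj₂)
open import Data.Sum using (_⊎_; inj₁; inj₂)
open import Data.Empty using (⊥-elim)
open import Data.Unit using (tt)
open import Data.Vec.Functional using (_∷_)
open import Function using (_∘_)
open import Relation.Unary using (_⊆_)
open import Relation.Binary.Definitions using (tri<; tri≈; tri>)
open import Relation.Binary.PropositionalEquality
open import Relation.Nullary using (yes; no)
open import Relation.Nullary.Decidable using (toWitness)

open ≡-Reasoning

≤⇒≡∨< : ∀ {p q} → p ≤ q → p ≡ q ⊎ p < q
≤⇒≡∨< {p} {q} p≤q with <-cmp p q
... | tri< p<q _ _ = inj₂ p<q
... | tri≈ _ p≡q _ = inj₁ p≡q
... | tri> _ _ q<p = ⊥-elim (<-irrefl refl (<-≤-trans q<p p≤q))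

*-nonNeg : ∀ {p q} → 0ℚ ≤ p → 0ℚ ≤ q → 0ℚ ≤ p * q
*-nonNeg {p} {q} 0≤p 0≤q =
  nonNegative⁻¹ _ {{nonNeg*nonNeg⇒nonNeg p {{nonNegative 0≤p}} q {{nonNegative 0≤q}}}}

1/-nonNeg : ∀ {p} (0<p : 0ℚ < p) → 0ℚ ≤ (1/ p) {{>-nonZero 0<p}}
1/-nonNeg {p} 0<p = <⇒≤ (positive⁻¹ _ {{1/pos⇒pos p {{positive 0<p}}}})

*-cancelˡ-≡ : ∀ r .{{_ : NonZero r}} {p q} → r * p ≡ r * q → p ≡ q
*-cancelˡ-≡ r {p} {q} rp≡rq = trans (sym (undo p)) (trans (cong (1/ r *_) rp≡rq) (undo q))
  where
  undo : ∀ x → 1/ r * (r * x) ≡ x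
  undo x = begin
    1/ r * (r * x)  ≡⟨ sym (*-assoc (1/ r) r x) ⟩
    (1/ r * r) * x  ≡⟨ cong (_* x) (*-inverseˡ r) ⟩
    1ℚ * x          ≡⟨ *-identityˡ x ⟩
    x               ∎

sumFin-cong : ∀ n {f g : Fin n → ℚ} → (∀ j → f j ≡ g j) → sumFin n f ≡ sumFin n g
sumFin-cong zero    f≗g = refl
sumFin-cong (suc n) f≗g = cong₂ _+_ (f≗g zero) (sumFin-cong n (f≗g ∘ suc))

sumFin-distrib-+ : ∀ n (f g : Fin n → ℚ) →
  sumFin n (λ j → f j + g j) ≡ sumFin n f + sumFin n g
sumFin-distrib-+ zero    f g = refl
sumFin-distrib-+ (suc n) f g =
  trans (cong (_+_ (f zero + g zero)) (sumFin-distrib-+ n (f ∘ suc) (g ∘ suc)))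
        (+-interchange (f zero) (g zero) _ _)

*-distribˡ-sumFin : ∀ n p (f : Fin n → ℚ) → sumFin n (λ j → p * f j) ≡ p * sumFin n f
*-distribˡ-sumFin zero    p f = sym (*-zeroʳ p)
*-distribˡ-sumFin (suc n) p f =
  trans (cong (_+_ (p * f zero)) (*-distribˡ-sumFin n p (f ∘ suc))) (sym (*-distribˡ-+ p _ _))

sumFin-zero : ∀ n {f : Fin n → ℚ} → (∀ j → f j ≡ 0ℚ) → sumFin n f ≡ 0ℚ
sumFin-zero zero    f≗0 = refl
sumFin-zero (suc n) f≗0 = trans (cong₂ _+_ (f≗0 zero) (sumFin-zero n (f≗0 ∘ suc))) (+-identityˡ 0ℚ)

sumFin-nonNeg : ∀ n {f : Fin n → ℚ} → (∀ j → 0ℚ ≤ f j) → 0ℚ ≤ sumFin n f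
sumFin-nonNeg zero    0≤f = ≤-refl
sumFin-nonNeg (suc n) 0≤f = +-mono-≤ (0≤f zero) (sumFin-nonNeg n (0≤f ∘ suc))

sumFin-nonNeg≡0⇒≡0 : ∀ n {f : Fin n → ℚ} → (∀ j → 0ℚ ≤ f j) → sumFin n f ≡ 0ℚ → ∀ j → f j ≡ 0ℚ
sumFin-nonNeg≡0⇒≡0 (suc n) {f} 0≤f Σf≡0 = λ
  { zero    → head≡0
  ; (suc j) → sumFin-nonNeg≡0⇒≡0 n (0≤f ∘ suc) tail≡0 j
  }
  where
  0≤tail : 0ℚ ≤ sumFin n (f ∘ suc)
  0≤tail = sumFin-nonNeg n (0≤f ∘ suc)
  head≤0 : f zero ≤ 0ℚ
  head≤0 = subst (f zero ≤_) Σf≡0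
    (subst (_≤ f zero + sumFin n (f ∘ suc)) (+-identityʳ (f zero)) (+-monoʳ-≤ (f zero) 0≤tail))
  head≡0 : f zero ≡ 0ℚ
  head≡0 = ≤-antisym head≤0 (0≤f zero)
  tail≡0 : sumFin n (f ∘ suc) ≡ 0ℚ
  tail≡0 = begin
    sumFin n (f ∘ suc)            ≡⟨ sym (+-identityˡ _) ⟩
    0ℚ + sumFin n (f ∘ suc)       ≡⟨ cong (_+ sumFin n (f ∘ suc)) (sym head≡0) ⟩
    f zero + sumFin n (f ∘ suc)   ≡⟨ Σf≡0 ⟩
    0ℚ                            ∎

ℤ→ℚ≡mkℚ : ∀ z → ℤ→ℚ z ≡ mkℚ z 0 (Coprimality.sym (Coprimality.1-coprimeTo _))
ℤ→ℚ≡mkℚ z = ↥p/↧p≡p (mkℚ z 0 _)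

ℤ→ℚ-+ : ∀ a b → ℤ→ℚ (a ℤ.+ b) ≡ ℤ→ℚ a + ℤ→ℚ b
-- mkℚ a 0 _ + mkℚ b 0 _ computes to (a * 1 + b * 1) / (1 * 1).
ℤ→ℚ-+ a b = sym (begin
  ℤ→ℚ a + ℤ→ℚ b                ≡⟨ cong₂ _+_ (ℤ→ℚ≡mkℚ a) (ℤ→ℚ≡mkℚ b) ⟩
  ℤ→ℚ (a ℤ.* + 1 ℤ.+ b ℤ.* + 1) ≡⟨ cong₂ (λ x y → ℤ→ℚ (x ℤ.+ y)) (ℤₚ.*-identityʳ a) (ℤₚ.*-identityʳ b) ⟩
  ℤ→ℚ (a ℤ.+ b)                ∎)

ℤ→ℚ-neg : ∀ a → ℤ→ℚ (ℤ.- a) ≡ - ℤ→ℚ a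
-- -[1+ n ] / 1 is defined as - (+[1+ n ] / 1).
ℤ→ℚ-neg (+ zero)   = refl
ℤ→ℚ-neg ℤ.+[1+ n ] = refl
ℤ→ℚ-neg ℤ.-[1+ n ] = sym (neg-involutive _)

IsIntegral-resp : ∀ {d} {x y : Point d} → x ≈ₚ y → IsIntegral x → IsIntegral y
IsIntegral-resp x≈y (k , x≈k) = k , λ i → trans (sym (x≈y i)) (x≈k i)

IsIntegral-+ : ∀ {d} {x y : Point d} → IsIntegral x → IsIntegral y → IsIntegral (x +ₚ y)
IsIntegral-+ (k , x≈k) (l , y≈l) =
  (λ i → k i ℤ.+ l i) , λ i → trans (cong₂ _+_ (x≈k i) (y≈l i)) (sym (ℤ→ℚ-+ (k i) (l i)))

IsIntegral-- : ∀ {d} {x y : Point d} → IsIntegral x → IsIntegral y → IsIntegral (x -ₚ y)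
IsIntegral-- {x = x} {y} (k , x≈k) (l , y≈l) = (λ i → k i ℤ.- l i) , λ i → begin
  x i - y i                     ≡⟨ cong₂ _-_ (x≈k i) (y≈l i) ⟩
  ℤ→ℚ (k i) + - ℤ→ℚ (l i)       ≡⟨ cong (_+_ (ℤ→ℚ (k i))) (sym (ℤ→ℚ-neg (l i))) ⟩
  ℤ→ℚ (k i) + ℤ→ℚ (ℤ.- l i)     ≡⟨ sym (ℤ→ℚ-+ (k i) (ℤ.- l i)) ⟩
  ℤ→ℚ (k i ℤ.- l i)             ∎

Convex : ∀ {d} → PSet d → Set
Convex Q = ∀ {x y} α β → 0ℚ ≤ α → 0ℚ ≤ β → α + β ≡ 1ℚ → Q x → Q y → Q ((α ·ₚ x) +ₚ (β ·ₚ y))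

conv-convex : ∀ {d} n (w : Fin n → Point d) → Convex (conv n w)
conv-convex n w {x} {y} α β 0≤α 0≤β α+β≡1 (μ , 0≤μ , Σμ≡1 , x≈) (ν , 0≤ν , Σν≡1 , y≈) =
  κ , (λ j → +-mono-≤ (*-nonNeg 0≤α (0≤μ j)) (*-nonNeg 0≤β (0≤ν j))) , Σκ≡1 , z≈
  where
  κ : Fin n → ℚ
  κ j = α * μ j + β * ν j
  sumFin-linear : ∀ (f g : Fin n → ℚ) →
    sumFin n (λ j → α * f j + β * g j) ≡ α * sumFin n f + β * sumFin n g
  sumFin-linear f g =
    trans (sumFin-distrib-+ n _ _) (cong₂ _+_ (*-distribˡ-sumFin n α f) (*-distribˡ-sumFin n β g))
  Σκ≡1 : sumFin n κ ≡ 1ℚ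
  Σκ≡1 = begin
    sumFin n κ                          ≡⟨ sumFin-linear μ ν ⟩
    α * sumFin n μ + β * sumFin n ν     ≡⟨ cong₂ (λ u v → α * u + β * v) Σμ≡1 Σν≡1 ⟩
    α * 1ℚ + β * 1ℚ                     ≡⟨ cong₂ _+_ (*-identityʳ α) (*-identityʳ β) ⟩
    α + β                               ≡⟨ α+β≡1 ⟩
    1ℚ                                  ∎
  z≈ : ∀ i → α * x i + β * y i ≡ sumFin n (λ j → κ j * w j i)
  z≈ i = begin
    α * x i + β * y i
      ≡⟨ cong₂ (λ u v → α * u + β * v) (x≈ i) (y≈ i) ⟩
    α * sumFin n (λ j → μ j * w j i) + β * sumFin n (λ j → ν j * w j i)
      ≡⟨ sym (sumFin-linear _ _) ⟩
    sumFin n (λ j → α * (μ j * w j i) + β * (ν j * w j i))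
      ≡⟨ sumFin-cong n (λ j → solve 5 (λ α β μ ν w → α :* (μ :* w) :+ β :* (ν :* w)
                                                   := (α :* μ :+ β :* ν) :* w)
                                      refl α β (μ j) (ν j) (w j i)) ⟩
    sumFin n (λ j → κ j * w j i)
      ∎

conv-resp-≈ₚ : ∀ {d n} {w : Fin n → Point d} {x y} → x ≈ₚ y → conv n w x → conv n w y
conv-resp-≈ₚ x≈y (μ , 0≤μ , Σμ≡1 , x≈) = μ , 0≤μ , Σμ≡1 , λ i → trans (sym (x≈y i)) (x≈ i)

conv-head : ∀ {d m} (w : Fin (suc m) → Point d) → conv (suc m) w (w zero)
conv-head {m = m} w =
  1ℚ ∷ (λ _ → 0ℚ) ,
  (λ { zero → <⇒≤ (positive⁻¹ 1ℚ) ; (suc j) → ≤-refl }) ,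
  cong (_+_ 1ℚ) (sumFin-zero m (λ _ → refl)) ,
  λ i → sym (begin
    1ℚ * w zero i + sumFin m (λ j → 0ℚ * w (suc j) i)
      ≡⟨ cong₂ _+_ (*-identityˡ (w zero i)) (sumFin-zero m (λ j → *-zeroˡ (w (suc j) i))) ⟩
    w zero i + 0ℚ
      ≡⟨ +-identityʳ (w zero i) ⟩
    w zero i
      ∎)

conv-tail-⊆ : ∀ {d m} (w : Fin (suc m) → Point d) → conv m (w ∘ suc) ⊆ conv (suc m) w
conv-tail-⊆ w (μ , 0≤μ , Σμ≡1 , x≈) =
  0ℚ ∷ μ ,
  (λ { zero → ≤-refl ; (suc j) → 0≤μ j }) ,
  trans (+-identityˡ _) Σμ≡1 ,
  λ i → trans (x≈ i) (sym (trans (cong (_+ sumFin _ (λ j → μ j * w (suc j) i)) (*-zeroˡ (w zero i)))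
                                 (+-identityˡ _)))

conv-normalise : ∀ {d n} (w : Fin n → Point d) {μ : Fin n → ℚ} → (∀ j → 0ℚ ≤ μ j) →
  0ℚ < sumFin n μ →
  ∃ λ y → conv n w y × (∀ i → sumFin n (λ j → μ j * w j i) ≡ sumFin n μ * y i)
conv-normalise {n = n} w {μ} 0≤μ 0<Σμ =
  (λ i → sumFin n (λ j → ν j * w j i)) , (ν , 0≤ν , Σν≡1 , λ i → refl) , μw≡Σμ*y
  where
  instance
    Σμ≢0 : NonZero (sumFin n μ)
    Σμ≢0 = >-nonZero 0<Σμ
  ν : Fin n → ℚ
  ν j = 1/ sumFin n μ * μ j
  0≤ν : ∀ j → 0ℚ ≤ ν j
  0≤ν j = *-nonNeg (1/-nonNeg 0<Σμ) (0≤μ j)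
  Σν≡1 : sumFin n ν ≡ 1ℚ
  Σν≡1 = trans (*-distribˡ-sumFin n (1/ sumFin n μ) μ) (*-inverseˡ (sumFin n μ))
  unscale : ∀ i j → sumFin n μ * (ν j * w j i) ≡ μ j * w j i
  unscale i j = begin
    T * ((1/ T * μ j) * w j i)
      ≡⟨ solve 4 (λ T r m w → T :* ((r :* m) :* w) := (T :* r) :* (m :* w)) refl T (1/ T) (μ j) (w j i) ⟩
    (T * 1/ T) * (μ j * w j i) ≡⟨ cong (_* (μ j * w j i)) (*-inverseʳ T) ⟩
    1ℚ * (μ j * w j i)         ≡⟨ *-identityˡ _ ⟩
    μ j * w j i                ∎
    where
    T : ℚ
    T = sumFin n μ
  μw≡Σμ*y : ∀ i → sumFin n (λ j → μ j * w j i) ≡ sumFin n μ * sumFin n (λ j → ν j * w j i)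
  μw≡Σμ*y i = trans (sumFin-cong n (sym ∘ unscale i)) (*-distribˡ-sumFin n (sumFin n μ) _)

conv-uncons : ∀ {d m} {w : Fin (suc m) → Point d} {x} → conv (suc m) w x →
  x ≈ₚ w zero ⊎
  ∃₂ λ t y → 0ℚ ≤ t × t < 1ℚ × conv m (w ∘ suc) y × x ≈ₚ ((t ·ₚ w zero) +ₚ ((1ℚ - t) ·ₚ y))
conv-uncons {m = m} {w} {x} (μ , 0≤μ , Σμ≡1 , x≈) with ≤⇒≡∨< (sumFin-nonNeg m (0≤μ ∘ suc))
... | inj₁ 0≡Σtail = inj₁ λ i → begin
  x i
    ≡⟨ x≈ i ⟩
  μ zero * w zero i + sumFin m (λ j → μ (suc j) * w (suc j) i)
    ≡⟨ cong₂ (λ a b → a * w zero i + b) μ₀≡1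
             (sumFin-zero m (λ j → trans (cong (_* w (suc j) i) (tail≡0 j)) (*-zeroˡ (w (suc j) i)))) ⟩
  1ℚ * w zero i + 0ℚ
    ≡⟨ trans (+-identityʳ (1ℚ * w zero i)) (*-identityˡ (w zero i)) ⟩
  w zero i
    ∎
  where
  tail≡0 : ∀ j → μ (suc j) ≡ 0ℚ
  tail≡0 = sumFin-nonNeg≡0⇒≡0 m (0≤μ ∘ suc) (sym 0≡Σtail)
  μ₀≡1 : μ zero ≡ 1ℚ
  μ₀≡1 = trans (sym (+-identityʳ (μ zero))) (trans (cong (_+_ (μ zero)) 0≡Σtail) Σμ≡1)
... | inj₂ 0<Σtail =
  let y , y∈ , tail≡Σtail*y = conv-normalise (w ∘ suc) (0≤μ ∘ suc) 0<Σtail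
  in inj₂ (μ zero , y , 0≤μ zero , μ₀<1 , y∈ , x≈segment tail≡Σtail*y)
  where
  Σtail : ℚ
  Σtail = sumFin m (μ ∘ suc)
  1-μ₀≡Σtail : 1ℚ - μ zero ≡ Σtail
  1-μ₀≡Σtail = trans (cong (_- μ zero) (sym Σμ≡1))
                     (solve 2 (λ a b → (a :+ b) :- a := b) refl (μ zero) Σtail)
  μ₀<1 : μ zero < 1ℚ
  μ₀<1 = subst₂ _<_ (+-identityʳ (μ zero)) Σμ≡1 (+-monoʳ-< (μ zero) 0<Σtail)
  x≈segment : ∀ {y} → (∀ i → sumFin m (λ j → μ (suc j) * w (suc j) i) ≡ Σtail * y i) →
    x ≈ₚ ((μ zero ·ₚ w zero) +ₚ ((1ℚ - μ zero) ·ₚ y))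
  x≈segment {y} tail≡Σtail*y i = begin
    x i
      ≡⟨ x≈ i ⟩
    μ zero * w zero i + sumFin m (λ j → μ (suc j) * w (suc j) i)
      ≡⟨ cong (_+_ (μ zero * w zero i)) (tail≡Σtail*y i) ⟩
    μ zero * w zero i + Σtail * y i
      ≡⟨ cong (λ t → μ zero * w zero i + t * y i) (sym 1-μ₀≡Σtail) ⟩
    μ zero * w zero i + (1ℚ - μ zero) * y i
      ∎

-- IsVertex Q v is definitionally Q v × Extreme Q v.
Extreme : ∀ {d} → PSet d → Point d → Set
Extreme Q v = ∀ x y t → Q x → Q y → 0ℚ < t → t < 1ℚ →
              v ≈ₚ ((t ·ₚ x) +ₚ ((1ℚ - t) ·ₚ y)) → x ≈ₚ v

extreme-conv : ∀ {d n} {w : Fin n → Point d} {Q : PSet d} → conv n w ⊆ Q →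
  ∀ {a} → Extreme Q a → conv n w a → ∃ λ j → a ≈ₚ w j
extreme-conv {n = zero} _ _ (_ , _ , () , _)
extreme-conv {n = suc m} {w} conv⊆Q {a} ext a∈ with conv-uncons {w = w} a∈
... | inj₁ a≈w₀ = zero , a≈w₀
... | inj₂ (t , y , 0≤t , t<1 , y∈ , a≈) with ≤⇒≡∨< 0≤t
...   | inj₂ 0<t =
  zero , λ i → sym (ext (w zero) y t (conv⊆Q (conv-head w)) (conv⊆Q (conv-tail-⊆ w y∈)) 0<t t<1 a≈ i)
...   | inj₁ refl =
  let j , a≈wj = extreme-conv (λ z∈ → conv⊆Q (conv-tail-⊆ w z∈)) ext (conv-resp-≈ₚ y≈a y∈)
  in suc j , a≈wj
  where
  y≈a : y ≈ₚ a
  y≈a i = sym (begin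
    a i                                          ≡⟨ a≈ i ⟩
    0ℚ * w zero i + (1ℚ - 0ℚ) * y i              ≡⟨ cong (_+ (1ℚ - 0ℚ) * y i) (*-zeroˡ (w zero i)) ⟩
    0ℚ + 1ℚ * y i                                ≡⟨ +-identityˡ (1ℚ * y i) ⟩
    1ℚ * y i                                     ≡⟨ *-identityˡ (y i) ⟩
    y i                                          ∎)

latticePolytope-vertex-integral : ∀ {d} n (v : Fin n → Fin d → ℤ) {a} →
  IsVertex (latticePolytope n v) a → IsIntegral a
latticePolytope-vertex-integral n v (a∈ , ext) =
  let j , a≈vj = extreme-conv (λ x∈ → x∈) ext a∈ in v j , a≈vj

⊆-dilate-1 : ∀ {d} {Q : PSet d} → Q ⊆ dilate 1ℚ Q
⊆-dilate-1 {x = x} x∈ = x , x∈ , λ i → sym (*-identityˡ (x i))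

minkowski-dilate-⊆ : ∀ {d} {Q : PSet d} → Convex Q → ∀ {s t} → 0ℚ ≤ s → 0ℚ < t →
  minkowski (dilate s Q) (dilate t Q) ⊆ dilate (s + t) Q
minkowski-dilate-⊆ convex {s} {t} 0≤s 0<t {x} (a , b , (p , p∈ , a≈sp) , (q , q∈ , b≈tq) , x≈a+b) =
  _ , convex (s * r) (t * r) (*-nonNeg 0≤s 0≤r) (*-nonNeg (<⇒≤ 0<t) 0≤r) weights≡1 p∈ q∈ , λ i → begin
    x i                                        ≡⟨ x≈a+b i ⟩
    a i + b i                                  ≡⟨ cong₂ _+_ (a≈sp i) (b≈tq i) ⟩
    s * p i + t * q i                          ≡⟨ sym (*-identityˡ _) ⟩
    1ℚ * (s * p i + t * q i)                   ≡⟨ cong (_* (s * p i + t * q i)) (sym (*-inverseʳ (s + t))) ⟩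
    ((s + t) * r) * (s * p i + t * q i)
      ≡⟨ solve 5 (λ s t r p q → ((s :+ t) :* r) :* (s :* p :+ t :* q)
                              := (s :+ t) :* ((s :* r) :* p :+ (t :* r) :* q)) refl s t r (p i) (q i) ⟩
    (s + t) * ((s * r) * p i + (t * r) * q i)  ∎
  where
  0<s+t : 0ℚ < s + t
  0<s+t = +-mono-≤-< 0≤s 0<t
  instance
    s+t≢0 : NonZero (s + t)
    s+t≢0 = >-nonZero 0<s+t
  r : ℚ
  r = 1/ (s + t)
  0≤r : 0ℚ ≤ r
  0≤r = 1/-nonNeg 0<s+t
  weights≡1 : s * r + t * r ≡ 1ℚ
  weights≡1 = trans (sym (*-distribʳ-+ r s t)) (*-inverseʳ (s + t))

*-distrib-segment : ∀ s t x y → s * (t * x + (1ℚ - t) * y) ≡ t * (s * x) + (1ℚ - t) * (s * y)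
*-distrib-segment = solve 4 (λ s t x y → s :* (t :* x :+ (con 1ℚ :- t) :* y)
                                      := t :* (s :* x) :+ (con 1ℚ :- t) :* (s :* y)) refl

IsVertex-dilate : ∀ {d} {Q : PSet d} s .{{_ : NonZero s}} {a} →
  IsVertex Q a → IsVertex (dilate s Q) (s ·ₚ a)
IsVertex-dilate {Q = Q} s {a} (a∈ , ext) = (a , a∈ , λ _ → refl) , ext′
  where
  ext′ : Extreme (dilate s Q) (s ·ₚ a)
  ext′ x y t (x′ , x′∈ , x≈sx′) (y′ , y′∈ , y≈sy′) 0<t t<1 sa≈ i =
    trans (x≈sx′ i) (cong (s *_) (ext x′ y′ t x′∈ y′∈ 0<t t<1 a≈ i))
    where
    a≈ : a ≈ₚ ((t ·ₚ x′) +ₚ ((1ℚ - t) ·ₚ y′))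
    a≈ k = *-cancelˡ-≡ s (begin
      s * a k                                 ≡⟨ sa≈ k ⟩
      t * x k + (1ℚ - t) * y k                ≡⟨ cong₂ (λ u v → t * u + (1ℚ - t) * v) (x≈sx′ k) (y≈sy′ k) ⟩
      t * (s * x′ k) + (1ℚ - t) * (s * y′ k)  ≡⟨ sym (*-distrib-segment s t (x′ k) (y′ k)) ⟩
      s * (t * x′ k + (1ℚ - t) * y′ k)        ∎)

IsVertex-undilate : ∀ {d} {Q : PSet d} s .{{_ : NonZero s}} {w} →
  IsVertex (dilate s Q) w → ∃ λ a → IsVertex Q a × w ≈ₚ (s ·ₚ a)
IsVertex-undilate {Q = Q} s {w} ((a , a∈ , w≈sa) , ext) = a , (a∈ , ext′) , w≈sa
  where
  ext′ : Extreme Q a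
  ext′ x y t x∈ y∈ 0<t t<1 a≈ i = *-cancelˡ-≡ s (trans (sx≈w i) (w≈sa i))
    where
    w≈ : w ≈ₚ ((t ·ₚ (s ·ₚ x)) +ₚ ((1ℚ - t) ·ₚ (s ·ₚ y)))
    w≈ k = trans (w≈sa k) (trans (cong (s *_) (a≈ k)) (*-distrib-segment s t (x k) (y k)))
    sx≈w : (s ·ₚ x) ≈ₚ w
    sx≈w = ext (s ·ₚ x) (s ·ₚ y) t (x , x∈ , λ _ → refl) (y , y∈ , λ _ → refl) 0<t t<1 w≈

minkowski-G-⊆-dilate : ∀ {d} {Q : PSet d} → Convex Q → ∀ {c} → 1ℚ ≤ c →
  minkowski (G (dilate (c - 1ℚ) Q)) Q ⊆ dilate c Q
minkowski-G-⊆-dilate {Q = Q} convex {c} 1≤c {x} (g , p , (g∈ , _) , p∈ , x≈g+p) =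
  subst (λ t → dilate t Q x) c-1+1≡c
    (minkowski-dilate-⊆ convex {c - 1ℚ} {1ℚ} 0≤c-1 0<1 (g , p , g∈ , ⊆-dilate-1 p∈ , x≈g+p))
  where
  c-1+1≡c : (c - 1ℚ) + 1ℚ ≡ c
  c-1+1≡c = solve 1 (λ c → (c :- con 1ℚ) :+ con 1ℚ := c) refl c
  0<1 : 0ℚ < 1ℚ
  0<1 = positive⁻¹ 1ℚ
  0≤c-1 : 0ℚ ≤ c - 1ℚ
  0≤c-1 = +-monoˡ-≤ (- 1ℚ) 1≤c

Decomposable : ∀ {d} → ℚ → PSet d → Set
Decomposable c Q = dilate c Q ⊆ minkowski (G (dilate (c - 1ℚ) Q)) Q

module _ {d} {Q : PSet d} (convex : Convex Q)
         (vertex-integral : ∀ {a} → IsVertex Q a → IsIntegral a) where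

  minkowski-G-G-⊆ : ∀ {s} → 0ℚ < s →
    minkowski (G (dilate s Q)) (G (dilate 1ℚ Q)) ⊆ G (dilate (s + 1ℚ) Q)
  minkowski-G-G-⊆ {s} 0<s {x}
    (g , z , (g∈ , W , W-vertex , g-W∈ℤ) , (z∈ , U , U-vertex , z-U∈ℤ) , x≈g+z) =
    let a , a-vertex , W≈sa = IsVertex-undilate s {{>-nonZero 0<s}} W-vertex
        b , b-vertex , U≈b  = IsVertex-undilate 1ℚ U-vertex
    in minkowski-dilate-⊆ convex (<⇒≤ 0<s) (positive⁻¹ 1ℚ) (g , z , g∈ , z∈ , x≈g+z) ,
       (s + 1ℚ) ·ₚ a , IsVertex-dilate (s + 1ℚ) {{>-nonZero 0<s+1}} a-vertex ,
       IsIntegral-resp (x-v≈ {a} {b} W≈sa U≈b)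
         (IsIntegral-+ (IsIntegral-+ g-W∈ℤ z-U∈ℤ)
                       (IsIntegral-- (vertex-integral b-vertex) (vertex-integral a-vertex)))
    where
    0<s+1 : 0ℚ < s + 1ℚ
    0<s+1 = <-trans 0<s (subst (_< s + 1ℚ) (+-identityʳ s) (+-monoʳ-< s (positive⁻¹ 1ℚ)))
    x-v≈ : ∀ {a b} → W ≈ₚ (s ·ₚ a) → U ≈ₚ (1ℚ ·ₚ b) →
      (((g -ₚ W) +ₚ (z -ₚ U)) +ₚ (b -ₚ a)) ≈ₚ (x -ₚ ((s + 1ℚ) ·ₚ a))
    x-v≈ {a} {b} W≈sa U≈b i = begin
      ((g i - W i) + (z i - U i)) + (b i - a i)
        ≡⟨ cong₂ (λ W U → ((g i - W) + (z i - U)) + (b i - a i)) (W≈sa i) (U≈b i) ⟩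
      ((g i - s * a i) + (z i - 1ℚ * b i)) + (b i - a i)
        ≡⟨ solve 5 (λ g z s a b → ((g :- s :* a) :+ (z :- con 1ℚ :* b)) :+ (b :- a)
                                := (g :+ z) :- (s :+ con 1ℚ) :* a) refl (g i) (z i) s (a i) (b i) ⟩
      (g i + z i) - (s + 1ℚ) * a i
        ≡⟨ cong (_- (s + 1ℚ) * a i) (sym (x≈g+z i)) ⟩
      x i - (s + 1ℚ) * a i
        ∎

  decomposable-step : ∀ {c} → two < c →
    Decomposable two Q → Decomposable (c - 1ℚ) Q → Decomposable c Q
  decomposable-step {c} 2<c decompose₂ decompose {x} (q , q∈ , x≈cq) =
    -- 1ℚ + 1ℚ and two - 1ℚ compute to two and 1ℚ, which is how p + q and z meet decompose₂.
    let g , p , g∈ , p∈ , cq≈g+p = decompose (q , q∈ , λ _ → refl)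
        z , r , z∈ , r∈ , p+q≈z+r = decompose₂ (minkowski-dilate-⊆ convex (<⇒≤ 0<1) 0<1
                                                 (p , q , ⊆-dilate-1 p∈ , ⊆-dilate-1 q∈ , λ _ → refl))
    in g +ₚ z , r ,
       subst (λ t → G (dilate t Q) (g +ₚ z)) s+1≡c-1
             (minkowski-G-G-⊆ 0<s (g , z , g∈ , z∈ , λ _ → refl)) ,
       r∈ , regroup {g} {p} {z} {r} cq≈g+p p+q≈z+r
    where
    0<1 : 0ℚ < 1ℚ
    0<1 = positive⁻¹ 1ℚ
    s : ℚ
    s = (c - 1ℚ) - 1ℚ
    0<s : 0ℚ < s
    0<s = +-monoˡ-< (- 1ℚ) (+-monoˡ-< (- 1ℚ) 2<c)
    s+1≡c-1 : s + 1ℚ ≡ c - 1ℚ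
    s+1≡c-1 = solve 1 (λ c → ((c :- con 1ℚ) :- con 1ℚ) :+ con 1ℚ := c :- con 1ℚ) refl c
    regroup : ∀ {g p z r} → ((c - 1ℚ) ·ₚ q) ≈ₚ (g +ₚ p) → (p +ₚ q) ≈ₚ (z +ₚ r) →
      x ≈ₚ ((g +ₚ z) +ₚ r)
    regroup {g} {p} {z} {r} cq≈g+p p+q≈z+r i = begin
      x i                    ≡⟨ x≈cq i ⟩
      c * q i                ≡⟨ solve 2 (λ c q → c :* q := (c :- con 1ℚ) :* q :+ q) refl c (q i) ⟩
      (c - 1ℚ) * q i + q i   ≡⟨ cong (_+ q i) (cq≈g+p i) ⟩
      (g i + p i) + q i      ≡⟨ +-assoc (g i) (p i) (q i) ⟩
      g i + (p i + q i)      ≡⟨ cong (_+_ (g i)) (p+q≈z+r i) ⟩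
      g i + (z i + r i)      ≡⟨ sym (+-assoc (g i) (z i) (r i)) ⟩
      (g i + z i) + r i      ∎

  decomposable-bounded : (∀ c → two ≤ c → c ≤ three → Decomposable c Q) →
    ∀ m {c} → two ≤ c → c ≤ three + ℤ→ℚ (+ m) → Decomposable c Q
  decomposable-bounded base zero {c} 2≤c c≤3 = base c 2≤c c≤3
  decomposable-bounded base (suc m) {c} 2≤c c≤3+m+1 with c ≤? three
  ... | yes c≤3 = base c 2≤c c≤3
  ... | no c≰3 =
    decomposable-step (<-trans 2<3 3<c) (base two ≤-refl (<⇒≤ 2<3))
      (decomposable-bounded base m (<⇒≤ (+-monoˡ-< (- 1ℚ) 3<c)) c-1≤3+m)
    where
    2<3 : two < three
    2<3 = toWitness {a? = two <? three} tt
    3<c : three < c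
    3<c = ≰⇒> c≰3
    c-1≤3+m : c - 1ℚ ≤ three + ℤ→ℚ (+ m)
    c-1≤3+m = subst (c - 1ℚ ≤_)
      (trans (cong (λ n → (three + n) - 1ℚ) (ℤ→ℚ-+ (+ 1) (+ m)))
             (solve 2 (λ a n → (a :+ (con 1ℚ :+ n)) :- con 1ℚ := a :+ n) refl three (ℤ→ℚ (+ m))))
      (+-monoˡ-≤ (- 1ℚ) c≤3+m+1)

archimedean : ∀ p → ∃ λ (m : ℕ) → p ≤ ℤ→ℚ (+ m)
archimedean p@(mkℚ (+ n) _ _) =
  n , subst (p ≤_) (sym (ℤ→ℚ≡mkℚ (+ n)))
            (*≤* (ℤₚ.*-monoˡ-≤-nonNeg (+ n) (ℤ.+≤+ (ℕ.s≤s ℕ.z≤n))))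
archimedean (mkℚ ℤ.-[1+ n ] _ _) = 0 , *≤* ℤ.-≤+

three-convexNormal⇒convexNormal : ∀ {d} {Q : PSet d} → Convex Q →
  (∀ {a} → IsVertex Q a → IsIntegral a) → ConvexNormal three Q → ∀ k → ConvexNormal k Q
three-convexNormal⇒convexNormal {Q = Q} convex vertex-integral normal₃ k c 2≤c c≤k =
  (λ x → decomposable-bounded convex vertex-integral base m 2≤c c≤3+m) ,
  (λ x → minkowski-G-⊆-dilate convex (≤-trans (toWitness {a? = 1ℚ ≤? two} tt) 2≤c))
  where
  base : ∀ c → two ≤ c → c ≤ three → Decomposable c Q
  base c 2≤c c≤3 {x} = proj₁ (normal₃ c 2≤c c≤3) x
  m : ℕ
  m = proj₁ (archimedean k)
  c≤3+m : c ≤ three + ℤ→ℚ (+ m)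
  c≤3+m = ≤-trans c≤k (≤-trans (proj₂ (archimedean k))
            (subst (_≤ three + ℤ→ℚ (+ m)) (+-identityˡ (ℤ→ℚ (+ m)))
                   (+-monoˡ-≤ (ℤ→ℚ (+ m)) (toWitness {a? = 0ℚ ≤? three} tt))))

mainTheorem1 : (d n : ℕ) (v : Fin n → Fin d → ℤ) →
    ConvexNormal three (latticePolytope n v) →
    (k : ℚ) → two ≤ k → ConvexNormal k (latticePolytope n v)
mainTheorem1 d n v normal₃ k _ =
  three-convexNormal⇒convexNormal (conv-convex n (λ j i → ℤ→ℚ (v j i)))
    (latticePolytope-vertex-integral n v) normal₃ k
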